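{- Let $G$ be a graph and let $G'$ be the graph constructed from $G$ as described in the context. If $G'$ has a $3$-C-E ordering, then $G$ is $3$-colourable.
   Context: All graphs are finite, simple and undirected. For an ordering $\phi$ of $V(G)$ write $a<_\phi b$ if $a$ precedes $b$; $w$ lies between $a$ and $b$ if $a<_\phi w<_\phi b$ or $b<_\phi w<_\phi a$. An ordering $\phi$ of $V(G)$ is a $3$-C-E ordering of $G$ if whenever $X,Y$ are triangles with $|X\cap Y|=2$, $X\setminus Y=\{a\}$, $Y\setminus X=\{b\}$, and both vertices of $X\cap Y$ lie between $a$ and $b$ in $\phi$, then $ab\in E(G)$. Construction of $G'$: its vertex set is $V(G)$ together with new distinct vertices $A=\{a,a_1,a_2,a_3\}$, $B=\{b,b_1,b_2,b_3\}$, $C=\{c,c_1,c_2,c_3\}$, $D=\{d,d_1,d_2,d_3\}$, $F=\{f^e_i: e\in E(G), 1\le i\le 6\}$ and $T=\{t^e_i: e\in E(G), 1\le i\le 3\}$. Its edges are exactly: all edges of $G$; all edges within each of $A,B,C,D$; for each $e\in E(G)$ and $i\in\{1,2,3\}$, all edges among $t^e_i,f^e_{2i-1},f^e_{2i}$; all edges between $\{a_1,a_2,a_3\}$ and $\{b_1,b_2,b_3\}$, between $\{b_1,b_2,b_3\}$ and $\{c_1,c_2,c_3\}$, between $\{c_1,c_2,c_3\}$ and $\{d_1,d_2,d_3\}$, and between $\{d_1,d_2,d_3\}$ and $\{a_1,a_2,a_3\}$; all edges between $\{a_1,a_2,a_3,b_1,b_2,b_3\}$ and $V(G)$; all edges between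 $\{c_1,c_2,c_3,d_1,d_2,d_3\}$ and $V(G)\cup F$; for each edge $e=uv\in E(G)$ and $1\le i\le 6$, the edges $f^e_iu$ and $f^e_iv$; all edges among the vertices $\{t^e_2,t^e_3: e\in E(G)\}$; and all edges between $\{t^e_1: e\in E(G)\}$ and $\{t^e_2,t^e_3: e\in E(G)\}$. -}

module Defs where

open import Data.Nat using (ℕ; _<_)
open import Data.Fin using (Fin; zero; suc) renaming (_<_ to _<ᶠ_)
open import Data.Bool using (Bool; true; false; T)
open import Data.Product using (Σ; _×_; _,_)
open import Data.Sum using (_⊎_)
open import Data.Unit using (⊤)
open import Data.Empty using (⊥)
open import Relation.Nullary using (¬_)
open import Relation.Binary.PropositionalEquality using (_≡_; _≢_)

record SimpleGraph (n : ℕ) : Set where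
  field
    adj    : Fin n → Fin n → Bool
    sym    : ∀ u v → adj u v ≡ adj v u
    irrefl : ∀ u → adj u u ≡ false

open SimpleGraph public

Adj : ∀ {n} → SimpleGraph n → Fin n → Fin n → Set
Adj G u v = T (adj G u v)

-- Edges of G: each unordered edge {u,v} represented once, with u < v.
Edge : ∀ {n} → SimpleGraph n → Set
Edge {n} G = Σ (Fin n) λ u → Σ (Fin n) λ v → (u <ᶠ v) × Adj G u v

ThreeColourable : ∀ {n} → SimpleGraph n → Set
ThreeColourable {n} G =
  Σ (Fin n → Fin 3) λ c → ∀ u v → Adj G u v → c u ≢ c v

-- An ordering φ is represented by an injective rank function V → ℕ;
-- a <_φ b  iff  rank a < rank b.

Injective : {V : Set} → (V → ℕ) → Set
Injective {V} rank = ∀ (x y : V) → rank x ≡ rank y → x ≡ y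

Between : {V : Set} → (V → ℕ) → V → V → V → Set
Between rank w a b =
  (rank a < rank w × rank w < rank b) ⊎ (rank b < rank w × rank w < rank a)

-- Triangles X = {a,x,y}, Y = {b,x,y} with |X ∩ Y| = 2 (i.e. a ≠ b),
-- X \ Y = {a}, Y \ X = {b}; if x, y both lie between a and b then ab ∈ E.
Is3CEOrdering : {V : Set} → (V → V → Set) → (V → ℕ) → Set
Is3CEOrdering {V} R rank =
  Injective rank ×
  (∀ (a b x y : V) →
     R x y → R a x → R a y → R b x → R b y → a ≢ b →
     Between rank x a b → Between rank y a b → R a b)

Has3CEOrdering : {V : Set} → (V → V → Set) → Set
Has3CEOrdering {V} R = Σ (V → ℕ) λ rank → Is3CEOrdering R rank

module Construction {n : ℕ} (G : SimpleGraph n) where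

  -- Vertices of G'.  For the 4-cliques A,B,C,D index zero is a (resp. b,c,d)
  -- and index suc i is a_{i+1}.  fv e k is f^e_{k+1} (k : Fin 6),
  -- tv e i is t^e_{i+1} (i : Fin 3).
  data V' : Set where
    gv : Fin n → V'
    av bv cv dv : Fin 4 → V'
    fv : Edge G → Fin 6 → V'
    tv : Edge G → Fin 3 → V'

  -- f^e_{2i-1}, f^e_{2i} belong to the triangle with t^e_i (0-based: k ↦ ⌊k/2⌋)
  pairOf : Fin 6 → Fin 3
  pairOf zero = zero
  pairOf (suc zero) = zero
  pairOf (suc (suc zero)) = suc zero
  pairOf (suc (suc (suc zero))) = suc zero
  pairOf (suc (suc (suc (suc zero)))) = suc (suc zero)
  pairOf (suc (suc (suc (suc (suc zero))))) = suc (suc zero)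

  Endpoint : Edge G → Fin n → Set
  Endpoint (u , v , _) w = (w ≡ u) ⊎ (w ≡ v)

  -- generating (one-directional) edge relation
  E₀ : V' → V' → Set
  E₀ (gv u) (gv v) = Adj G u v
  E₀ (av i) (av j) = i ≢ j
  E₀ (bv i) (bv j) = i ≢ j
  E₀ (cv i) (cv j) = i ≢ j
  E₀ (dv i) (dv j) = i ≢ j
  -- triangles t^e_i f^e_{2i-1} f^e_{2i}
  E₀ (tv e i) (fv e' k) = (e ≡ e') × (pairOf k ≡ i)
  E₀ (fv e k) (fv e' k') = (e ≡ e') × (pairOf k ≡ pairOf k') × (k ≢ k')
  -- the 4-cycle of complete bipartite joins a_* – b_* – c_* – d_* – a_*
  E₀ (av (suc _)) (bv (suc _)) = ⊤
  E₀ (bv (suc _)) (cv (suc _)) = ⊤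
  E₀ (cv (suc _)) (dv (suc _)) = ⊤
  E₀ (dv (suc _)) (av (suc _)) = ⊤
  E₀ (av (suc _)) (gv _) = ⊤
  E₀ (bv (suc _)) (gv _) = ⊤
  E₀ (cv (suc _)) (gv _) = ⊤
  E₀ (dv (suc _)) (gv _) = ⊤
  E₀ (cv (suc _)) (fv _ _) = ⊤
  E₀ (dv (suc _)) (fv _ _) = ⊤
  E₀ (fv e _) (gv w) = Endpoint e w
  -- clique on {t^e_2, t^e_3 : e ∈ E(G)}
  E₀ (tv e (suc i)) (tv e' (suc j)) = ¬ ((e ≡ e') × (i ≡ j))
  E₀ (tv _ zero) (tv _ (suc _)) = ⊤
  E₀ _ _ = ⊥

  E' : V' → V' → Set
  E' x y = E₀ x y ⊎ E₀ y x

{-# OPTIONS --safe #-}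
module Submission where

open import Defs
open import Data.Nat using (ℕ; _<_)
open import Data.Nat.Properties using (<-cmp; <-trans)
open import Data.Fin using (Fin; zero; suc)
import Data.Fin.Properties as Fin
open import Data.Bool using (T)
open import Data.Bool.Properties using (T-irrelevant)
open import Data.Product using (Σ; ∃; ∃₂; _×_; _,_; proj₁)
open import Data.Sum using (_⊎_; inj₁; inj₂; [_,_]′; swap)
open import Data.Unit using (tt)
open import Data.Empty using (⊥; ⊥-elim)
open import Function using (flip; _∘_)
open import Relation.Nullary using (¬_; Dec; yes; no)
open import Relation.Nullary.Decidable using (_×-dec_; map′; T?)
open import Relation.Nullary.Irrelevant using (Irrelevant)
open import Relation.Binary
  using (IsStrictTotalOrder; isStrictTotalOrderᶜ; Transitive; Trichotomous; tri<; tri≈; tri>)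
import Relation.Binary.Construct.Flip.EqAndOrd as Flip
import Relation.Binary.Construct.StrictToNonStrict as StrictToNonStrict
open import Relation.Binary.PropositionalEquality
  using (_≡_; _≢_; refl; cong; cong₂; subst)
import Relation.Binary.PropositionalEquality as ≡

-- In a 3-C-E ordering no vertex w of G comes after all of a₁,a₂,a₃,b₁,b₂,b₃: otherwise the
-- earliest of them, say a_j, and w enclose the triangle b₁b₂b₃, two of whose vertices lie on
-- the same side of b, which makes b adjacent to a_j or to w. Hence for an edge e = uv each
-- f^e_k lies between u and v (else every a_i, b_i would precede the later endpoint), and then
-- so does each t^e_i (else t^e_i would be adjacent to an endpoint); the reversed ordering gives
-- the mirror statements. Colour w by whether some t^{e'}_1 precedes it and whether some
-- follows it. As t^e_1 lies between u and v, adjacent vertices u ≺ v can only share a colour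
-- if t^{e'}_1 ≺ u and v ≺ t^{e''}_1; but then t^{e'}_1 and t^{e''}_1 enclose the edge
-- t^e_2 t^e_3 and would have to be adjacent.

Between≺ : {V : Set} → (V → V → Set) → V → V → V → Set
Between≺ _≺_ w a b = (a ≺ w × w ≺ b) ⊎ (b ≺ w × w ≺ a)

record CEOrdering {V : Set} (R : V → V → Set) : Set₁ where
  field
    _≺_                : V → V → Set
    isStrictTotalOrder : IsStrictTotalOrder _≡_ _≺_
    closes-diamond     : ∀ {a b x y} → R x y → R a x → R a y → R b x → R b y → a ≢ b →
                         Between≺ _≺_ x a b → Between≺ _≺_ y a b → R a b

  open IsStrictTotalOrder isStrictTotalOrder public

rankOrdering : {V : Set} {R : V → V → Set} {rank : V → ℕ} →
               Is3CEOrdering R rank → CEOrdering R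
rankOrdering {rank = rank} (injective , diamond) = record
  { _≺_                = λ x y → rank x < rank y
  ; isStrictTotalOrder = isStrictTotalOrderᶜ record
      { isEquivalence = ≡.isEquivalence ; trans = <-trans ; compare = compare }
  ; closes-diamond     = diamond _ _ _ _
  }
  where
  compare : Trichotomous _≡_ (λ x y → rank x < rank y)
  compare x y with <-cmp (rank x) (rank y)
  ... | tri< x<y x≢y x≯y = tri< x<y (x≢y ∘ cong rank) x≯y
  ... | tri≈ x≮y x≡y x≯y = tri≈ x≮y (injective x y x≡y) x≯y
  ... | tri> x≮y x≢y x>y = tri> x≮y (x≢y ∘ cong rank) x>y

reverse : {V : Set} {R : V → V → Set} → CEOrdering R → CEOrdering R
reverse O = record
  { _≺_                = flip _≺_
  ; isStrictTotalOrder = Flip.isStrictTotalOrder isStrictTotalOrder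
  ; closes-diamond     = λ Rxy Rax Ray Rbx Rby a≢b x∈ab y∈ab →
      closes-diamond Rxy Rax Ray Rbx Rby a≢b (unflip x∈ab) (unflip y∈ab)
  }
  where
  open CEOrdering O
  unflip : ∀ {w a b} → Between≺ (flip _≺_) w a b → Between≺ _≺_ w a b
  unflip (inj₁ (w≺a , b≺w)) = inj₂ (b≺w , w≺a)
  unflip (inj₂ (w≺b , a≺w)) = inj₁ (a≺w , w≺b)

two-on-one-side : {P Q : Fin 3 → Set} → (∀ i → P i ⊎ Q i) →
                  ∃₂ λ i j → i ≢ j × ((P i × P j) ⊎ (Q i × Q j))
two-on-one-side side with side zero | side (suc zero) | side (suc (suc zero))
... | inj₁ p₀ | inj₁ p₁ | _       = zero , suc zero , (λ ()) , inj₁ (p₀ , p₁)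
... | inj₂ q₀ | inj₂ q₁ | _       = zero , suc zero , (λ ()) , inj₂ (q₀ , q₁)
... | inj₁ p₀ | inj₂ _  | inj₁ p₂ = zero , suc (suc zero) , (λ ()) , inj₁ (p₀ , p₂)
... | inj₂ q₀ | inj₁ _  | inj₂ q₂ = zero , suc (suc zero) , (λ ()) , inj₂ (q₀ , q₂)
... | inj₂ _  | inj₁ p₁ | inj₁ p₂ = suc zero , suc (suc zero) , (λ ()) , inj₁ (p₁ , p₂)
... | inj₁ _  | inj₂ q₁ | inj₂ q₂ = suc zero , suc (suc zero) , (λ ()) , inj₂ (q₁ , q₂)

module CEOrderingProperties {V : Set} {R : V → V → Set} (O : CEOrdering R) where
  open CEOrdering O
  open StrictToNonStrict _≡_ _≺_ using (_≤_; <-≤-trans; total)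

  ≤-trans : Transitive _≤_
  ≤-trans = StrictToNonStrict.trans _≡_ _≺_ isEquivalence <-resp-≈ trans

  ≺-≤-trans : ∀ {x y z} → x ≺ y → y ≤ z → x ≺ z
  ≺-≤-trans = <-≤-trans trans <-respʳ-≈

  ≢⇒≺⊎≻ : ∀ {x y} → x ≢ y → x ≺ y ⊎ y ≺ x
  ≢⇒≺⊎≻ {x} {y} x≢y with compare x y
  ... | tri< x≺y _ _ = inj₁ x≺y
  ... | tri≈ _ x≡y _ = ⊥-elim (x≢y x≡y)
  ... | tri> _ _ y≺x = inj₂ y≺x

  least-of-three : (g : Fin 3 → V) → ∃ λ j → ∀ i → g j ≤ g i
  least-of-three g with total compare (g zero) (g (suc zero))
  ... | inj₁ g₀≤g₁ with total compare (g zero) (g (suc (suc zero)))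
  ...   | inj₁ g₀≤g₂ = zero , λ
    { zero → inj₂ refl ; (suc zero) → g₀≤g₁ ; (suc (suc zero)) → g₀≤g₂ }
  ...   | inj₂ g₂≤g₀ = suc (suc zero) , λ
    { zero → g₂≤g₀ ; (suc zero) → ≤-trans g₂≤g₀ g₀≤g₁ ; (suc (suc zero)) → inj₂ refl }
  least-of-three g | inj₂ g₁≤g₀ with total compare (g (suc zero)) (g (suc (suc zero)))
  ...   | inj₁ g₁≤g₂ = suc zero , λ
    { zero → g₁≤g₀ ; (suc zero) → inj₂ refl ; (suc (suc zero)) → g₁≤g₂ }
  ...   | inj₂ g₂≤g₁ = suc (suc zero) , λ
    { zero → ≤-trans g₂≤g₁ g₁≤g₀ ; (suc zero) → g₂≤g₁ ; (suc (suc zero)) → inj₂ refl }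

  between-ordered : ∀ {w x y} → x ≺ y → Between≺ _≺_ w x y → x ≺ w × w ≺ y
  between-ordered _   (inj₁ x≺w≺y)       = x≺w≺y
  between-ordered x≺y (inj₂ (y≺w , w≺x)) = ⊥-elim (asym x≺y (trans y≺w w≺x))

  not-beyond⇒between : ∀ {w x y} → w ≢ x → w ≢ y →
                        ¬ (w ≺ x × w ≺ y) → ¬ (x ≺ w × y ≺ w) → Between≺ _≺_ w x y
  not-beyond⇒between w≢x w≢y ¬before ¬after with ≢⇒≺⊎≻ w≢x | ≢⇒≺⊎≻ w≢y
  ... | inj₁ w≺x | inj₁ w≺y = ⊥-elim (¬before (w≺x , w≺y))
  ... | inj₁ w≺x | inj₂ y≺w = inj₂ (y≺w , w≺x)
  ... | inj₂ x≺w | inj₁ w≺y = inj₁ (x≺w , w≺y)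
  ... | inj₂ x≺w | inj₂ y≺w = ⊥-elim (¬after (x≺w , y≺w))

  not-before-both : ∀ {w x y} → x ≢ y → (x ≺ y → w ≺ x → ⊥) → (y ≺ x → w ≺ y → ⊥) →
                    ¬ (w ≺ x × w ≺ y)
  not-before-both x≢y ¬x-first ¬y-first (w≺x , w≺y) with ≢⇒≺⊎≻ x≢y
  ... | inj₁ x≺y = ¬x-first x≺y w≺x
  ... | inj₂ y≺x = ¬y-first y≺x w≺y

  closes-diamond-forward : ∀ {a b x y} → R x y → R a x → R a y → R b x → R b y →
                           a ≺ x → x ≺ b → a ≺ y → y ≺ b → R a b
  closes-diamond-forward Rxy Rax Ray Rbx Rby a≺x x≺b a≺y y≺b =
    closes-diamond Rxy Rax Ray Rbx Rby (λ { refl → asym a≺x x≺b })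
                   (inj₁ (a≺x , x≺b)) (inj₁ (a≺y , y≺b))

  precedes-unless-adjacent : ∀ {f x y s} → R x y → R f x → R f y → R s x → R s y →
                             s ≢ y → ¬ R f s → f ≺ x → x ≺ y → s ≺ y
  precedes-unless-adjacent Rxy Rfx Rfy Rsx Rsy s≢y ¬Rfs f≺x x≺y with ≢⇒≺⊎≻ s≢y
  ... | inj₁ s≺y = s≺y
  ... | inj₂ y≺s = ⊥-elim (¬Rfs (closes-diamond-forward Rxy Rfx Rfy Rsx Rsy
                                   f≺x (trans x≺y y≺s) (trans f≺x x≺y) y≺s))

  common-neighbour-adjacent-to-an-end :
    ∀ {p q q′} (g : Fin 3 → V) → (∀ i j → i ≢ j → R (g i) (g j)) →
    (∀ i → R p (g i)) → (∀ i → R q (g i)) → (∀ i → R q′ (g i)) → (∀ i → g i ≢ p) →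
    (∀ i → q ≺ g i) → (∀ i → g i ≺ q′) → R q p ⊎ R p q′
  common-neighbour-adjacent-to-an-end g Rgg Rp Rq Rq′ g∌p q≺g g≺q′
    with two-on-one-side (≢⇒≺⊎≻ ∘ g∌p)
  ... | i , j , i≢j , inj₁ (gi≺p , gj≺p) =
    inj₁ (closes-diamond-forward (Rgg i j i≢j) (Rq i) (Rq j) (Rp i) (Rp j)
                                 (q≺g i) gi≺p (q≺g j) gj≺p)
  ... | i , j , i≢j , inj₂ (p≺gi , p≺gj) =
    inj₂ (closes-diamond-forward (Rgg i j i≢j) (Rp i) (Rp j) (Rq′ i) (Rq′ j)
                                 p≺gi (g≺q′ i) p≺gj (g≺q′ j))

dec-Σ-irrelevant : {A : Set} {B : A → Set} → Irrelevant A → Dec A → (∀ a → Dec (B a)) →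
                   Dec (Σ A B)
dec-Σ-irrelevant _   (no ¬a) _  = no (¬a ∘ proj₁)
dec-Σ-irrelevant {B = B} irr (yes a) B? =
  map′ (a ,_) (λ (a′ , b) → subst B (irr a′ a) b) (B? a)

any-edge? : ∀ {n} {G : SimpleGraph n} {P : Edge G → Set} → (∀ e → Dec (P e)) → Dec (∃ P)
any-edge? {G = G} P? =
  map′ (λ (u , v , h , p) → (u , v , h) , p) (λ ((u , v , h) , p) → u , v , h , p)
    (Fin.any? λ u → Fin.any? λ v →
      dec-Σ-irrelevant
        (λ (p , q) (p′ , q′) → cong₂ _,_ (Fin.<-irrelevant p p′) (T-irrelevant q q′))
        (u Fin.<? v ×-dec T? (adj G u v))
        (λ h → P? (u , v , h)))

zoneColour : {P Q : Set} → Dec P → Dec Q → Fin 3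
zoneColour (no _)  _       = zero
zoneColour (yes _) (yes _) = suc zero
zoneColour (yes _) (no _)  = suc (suc zero)

zoneColour-≡ : {P Q P′ Q′ : Set} (p? : Dec P) (q? : Dec Q) (p′? : Dec P′) (q′? : Dec Q′) →
               zoneColour p? q? ≡ zoneColour p′? q′? →
               (¬ P × ¬ P′) ⊎ (¬ Q × ¬ Q′) ⊎ (P × Q × P′ × Q′)
zoneColour-≡ (no ¬p) _        (no ¬p′) _        _  = inj₁ (¬p , ¬p′)
zoneColour-≡ (yes _) (no ¬q)  (yes _)  (no ¬q′) _  = inj₂ (inj₁ (¬q , ¬q′))
zoneColour-≡ (yes p) (yes q)  (yes p′) (yes q′) _  = inj₂ (inj₂ (p , q , p′ , q′))
zoneColour-≡ (no _)  _        (yes _)  (yes _)  ()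
zoneColour-≡ (no _)  _        (yes _)  (no _)   ()
zoneColour-≡ (yes _) (yes _)  (no _)   _        ()
zoneColour-≡ (yes _) (no _)   (no _)   _        ()
zoneColour-≡ (yes _) (yes _)  (yes _)  (no _)   ()
zoneColour-≡ (yes _) (no _)   (yes _)  (yes _)  ()

module _ {n : ℕ} (G : SimpleGraph n) where
  open Construction G

  end₁ end₂ : Edge G → V'
  end₁ (u , _ , _) = gv u
  end₂ (_ , v , _) = gv v

  end₁≢end₂ : ∀ e → end₁ e ≢ end₂ e
  end₁≢end₂ (_ , _ , u<v , _) refl = Fin.<-irrefl refl u<v

  adj-irreflexive : ∀ {u v} → Adj G u v → u ≢ v
  adj-irreflexive {u} uv refl = subst T (SimpleGraph.irrefl G u) uv

  f-pair : ∀ i → ∃₂ λ k k′ → k ≢ k′ × pairOf k ≡ i × pairOf k′ ≡ i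
  f-pair zero             = zero , suc zero , (λ ()) , refl , refl
  f-pair (suc zero)       = suc (suc zero) , suc (suc (suc zero)) , (λ ()) , refl , refl
  f-pair (suc (suc zero)) =
    suc (suc (suc (suc zero))) , suc (suc (suc (suc (suc zero)))) , (λ ()) , refl , refl

  module _ (O : CEOrdering E') where
    open CEOrdering O
    open CEOrderingProperties O

    ab-not-all-before : ∀ w → (∀ i → av (suc i) ≺ gv w) → (∀ i → bv (suc i) ≺ gv w) → ⊥
    ab-not-all-before w a≺w b≺w with least-of-three (av ∘ suc) | least-of-three (bv ∘ suc)
    ... | ja , a-least | jb , b-least with compare (av (suc ja)) (bv (suc jb))
    ... | tri< aj≺bj _ _ =
      [ (λ { (inj₁ ()) ; (inj₂ ()) }) , (λ { (inj₁ ()) ; (inj₂ ()) }) ]′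
        (common-neighbour-adjacent-to-an-end {p = bv zero} (bv ∘ suc)
          (λ i j i≢j → inj₁ (i≢j ∘ Fin.suc-injective))
          (λ _ → inj₁ (λ ())) (λ _ → inj₁ tt) (λ _ → inj₂ tt) (λ _ ())
          (λ i → ≺-≤-trans aj≺bj (b-least i)) b≺w)
    ... | tri≈ _ () _
    ... | tri> _ _ bj≺aj =
      [ (λ { (inj₁ ()) ; (inj₂ ()) }) , (λ { (inj₁ ()) ; (inj₂ ()) }) ]′
        (common-neighbour-adjacent-to-an-end {p = av zero} (av ∘ suc)
          (λ i j i≢j → inj₁ (i≢j ∘ Fin.suc-injective))
          (λ _ → inj₁ (λ ())) (λ _ → inj₂ tt) (λ _ → inj₂ tt) (λ _ ())
          (λ i → ≺-≤-trans bj≺aj (a-least i)) a≺w)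

    F-not-before-ends : ∀ e k → ¬ (fv e k ≺ end₁ e × fv e k ≺ end₂ e)
    F-not-before-ends e@(_ , _ , _ , uv) k =
      not-before-both (end₁≢end₂ e) (before-lower (inj₁ refl) (inj₂ refl) (inj₁ uv))
                                    (before-lower (inj₂ refl) (inj₁ refl) (inj₂ uv))
      where
      before-lower : ∀ {x y} → Endpoint e x → Endpoint e y → E' (gv x) (gv y) →
                     gv x ≺ gv y → fv e k ≺ gv x → ⊥
      before-lower {y = y} e∋x e∋y xy x≺y f≺x = ab-not-all-before y
        (λ _ → precedes-unless-adjacent xy (inj₁ e∋x) (inj₁ e∋y) (inj₁ tt) (inj₁ tt) (λ ())
                 (λ { (inj₁ ()) ; (inj₂ ()) }) f≺x x≺y)
        (λ _ → precedes-unless-adjacent xy (inj₁ e∋x) (inj₁ e∋y) (inj₁ tt) (inj₁ tt) (λ ())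
                 (λ { (inj₁ ()) ; (inj₂ ()) }) f≺x x≺y)

  -- Each of the following blocks uses the previous one both for O and for reverse O.
  module _ (O : CEOrdering E') where
    open CEOrdering O
    open CEOrderingProperties O

    F-between : ∀ e k → Between≺ _≺_ (fv e k) (end₁ e) (end₂ e)
    F-between e k = not-beyond⇒between (λ ()) (λ ())
      (F-not-before-ends O e k) (F-not-before-ends (reverse O) e k)

    T-not-before-ends : ∀ e i → ¬ (tv e i ≺ end₁ e × tv e i ≺ end₂ e)
    T-not-before-ends e i =
      not-before-both (end₁≢end₂ e) (before-lower (inj₂ refl) (F-between e))
                                    (before-lower (inj₁ refl) (swap ∘ F-between e))
      where
      before-lower : ∀ {x y} → Endpoint e y → (∀ k → Between≺ _≺_ (fv e k) (gv x) (gv y)) →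
                     gv x ≺ gv y → tv e i ≺ gv x → ⊥
      before-lower e∋y f∈xy x≺y t≺x with f-pair i
      ... | k , k′ , k≢k′ , k∈i , k′∈i
        with between-ordered x≺y (f∈xy k) | between-ordered x≺y (f∈xy k′)
      ... | x≺f , f≺y | x≺f′ , f′≺y =
        [ (λ ()) , (λ ()) ]′
          (closes-diamond-forward (inj₁ (refl , ≡.trans k∈i (≡.sym k′∈i) , k≢k′))
            (inj₁ (refl , k∈i)) (inj₁ (refl , k′∈i)) (inj₂ e∋y) (inj₂ e∋y)
            (trans t≺x x≺f) f≺y (trans t≺x x≺f′) f′≺y)

  module _ (O : CEOrdering E') where
    open CEOrdering O
    open CEOrderingProperties O

    T-between : ∀ e i → Between≺ _≺_ (tv e i) (end₁ e) (end₂ e)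
    T-between e i = not-beyond⇒between (λ ()) (λ ())
      (T-not-before-ends O e i) (T-not-before-ends (reverse O) e i)

    T-between-adjacent : ∀ {u v} → Adj G u v → ∃ λ e → ∀ i → Between≺ _≺_ (tv e i) (gv u) (gv v)
    T-between-adjacent {u} {v} uv with Fin.<-cmp u v
    ... | tri< u<v _ _  = (u , v , u<v , uv) , T-between _
    ... | tri≈ _ u≡v _  = ⊥-elim (adj-irreflexive uv u≡v)
    ... | tri> _ _ v<u  = (v , u , v<u , subst T (SimpleGraph.sym G u v) uv) , swap ∘ T-between _

    T₁s-cannot-enclose-T₂T₃ : ∀ {e a b x y} → tv a zero ≺ x → y ≺ tv b zero → x ≺ y →
                              Between≺ _≺_ (tv e (suc zero)) x y →
                              Between≺ _≺_ (tv e (suc (suc zero))) x y → ⊥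
    T₁s-cannot-enclose-T₂T₃ a≺x y≺b x≺y t₂∈xy t₃∈xy
      with between-ordered x≺y t₂∈xy | between-ordered x≺y t₃∈xy
    ... | x≺t₂ , t₂≺y | x≺t₃ , t₃≺y =
      [ (λ ()) , (λ ()) ]′
        (closes-diamond-forward (inj₁ (λ { (_ , ()) })) (inj₁ tt) (inj₁ tt) (inj₁ tt) (inj₁ tt)
          (trans a≺x x≺t₂) (trans t₂≺y y≺b) (trans a≺x x≺t₃) (trans t₃≺y y≺b))

    Preceded Followed : Fin n → Set
    Preceded w = ∃ λ e → tv e zero ≺ gv w
    Followed w = ∃ λ e → gv w ≺ tv e zero

    preceded? : ∀ w → Dec (Preceded w)
    preceded? w = any-edge? {G = G} λ e → tv e zero <? gv w

    followed? : ∀ w → Dec (Followed w)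
    followed? w = any-edge? {G = G} λ e → gv w <? tv e zero

    colour : Fin n → Fin 3
    colour w = zoneColour (preceded? w) (followed? w)

    colour-proper : ∀ u v → Adj G u v → colour u ≢ colour v
    colour-proper u v uv same
      with T-between-adjacent uv
         | zoneColour-≡ (preceded? u) (followed? u) (preceded? v) (followed? v) same
    ... | e , t∈uv | inj₁ (¬u-preceded , ¬v-preceded) with t∈uv zero
    ...   | inj₁ (_ , t≺v) = ¬v-preceded (e , t≺v)
    ...   | inj₂ (_ , t≺u) = ¬u-preceded (e , t≺u)
    colour-proper u v uv same | e , t∈uv | inj₂ (inj₁ (¬u-followed , ¬v-followed))
      with t∈uv zero
    ...   | inj₁ (u≺t , _) = ¬u-followed (e , u≺t)
    ...   | inj₂ (v≺t , _) = ¬v-followed (e , v≺t)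
    colour-proper u v uv same
      | e , t∈uv | inj₂ (inj₂ ((_ , a≺u) , (_ , u≺b) , (_ , a′≺v) , (_ , v≺b′)))
      with ≢⇒≺⊎≻ {gv u} {gv v} (λ { refl → adj-irreflexive uv refl })
    ...   | inj₁ u≺v = T₁s-cannot-enclose-T₂T₃ a≺u v≺b′ u≺v
                         (t∈uv (suc zero)) (t∈uv (suc (suc zero)))
    ...   | inj₂ v≺u = T₁s-cannot-enclose-T₂T₃ a′≺v u≺b v≺u
                         (swap (t∈uv (suc zero))) (swap (t∈uv (suc (suc zero))))

mainTheorem13 : ∀ {n} (G : SimpleGraph n) →
    Has3CEOrdering (Construction.E' G) → ThreeColourable G
mainTheorem13 G (rank , isCE) = colour G O , colour-proper G O
  where O = rankOrdering isCE
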